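{- Let $S=(\mathcal{P},\mathcal{L})$ be a finite linear space and $G\leq\mathrm{Aut}(S)$ transitive on $\mathcal{L}$; let $\ell\in\mathcal{L}$. If $R$ is a linear space with point set $\mathcal{P}$ that is a refinement of $S$ and satisfies $G\leq\mathrm{Aut}(R)$, then there exists a linear space $T=(\mathcal{P}(\ell),\mathcal{TL})$ with $G_\ell^\ell\leq\mathrm{Aut}(T)$ such that the set of lines of $R$ equals $\{t^g: t\in\mathcal{TL}, g\in G\}$.
   Context: A linear space consists of points and lines (subsets of the point set) such that every pair of distinct points lies in exactly one line; automorphisms are permutations of the points preserving the set of lines. $\mathcal{P}(\ell)$ is the set of points on $\ell$; $G_\ell$ is the setwise stabiliser of $\mathcal{P}(\ell)$ in $G$ and $G_\ell^\ell$ the permutation group it induces on $\mathcal{P}(\ell)$. A linear space $R$ on $\mathcal{P}$ is a refinement of $S$ if every line of $R$ is contained in some line of $S$. -}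

module Defs where

open import Data.Nat using (ℕ; _≥_)
open import Data.Fin using (Fin)
open import Data.Fin.Subset using (Subset; _∈_; _⊆_; ∣_∣)
open import Data.Fin.Permutation using (Permutation′; _⟨$⟩ˡ_; _⟨$⟩ʳ_; id; flip; _∘ₚ_; _≈_)
open import Data.Vec using (tabulate; lookup)
open import Data.Product using (Σ; _×_)
open import Relation.Binary.PropositionalEquality using (_≡_; _≢_)
open import Level using (suc; zero)

LineSet : ℕ → Set₁
LineSet n = Subset n → Set

record IsLinearSpaceOn {n : ℕ} (pts : Subset n) (L : LineSet n) : Set where
  field
    line⊆     : ∀ l → L l → l ⊆ pts
    line≥2    : ∀ l → L l → ∣ l ∣ ≥ 2
    join      : ∀ x y → x ∈ pts → y ∈ pts → x ≢ y →
                Σ (Subset n) λ l → L l × x ∈ l × y ∈ l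
    join-uniq : ∀ x y → x ≢ y → ∀ l m → L l → L m →
                x ∈ l → y ∈ l → x ∈ m → y ∈ m → l ≡ m

-- Image l^π of a subset under a permutation: x ∈ l^π iff π⁻¹(x) ∈ l.
_^_ : {n : ℕ} → Subset n → Permutation′ n → Subset n
l ^ π = tabulate λ x → lookup l (π ⟨$⟩ˡ x)

IsAut : {n : ℕ} → LineSet n → Permutation′ n → Set
IsAut L π = ∀ l → (L l → L (l ^ π)) × (L (l ^ π) → L l)

record IsSubgroup {n : ℕ} (G : Permutation′ n → Set) : Set where
  field
    resp  : ∀ {π σ} → π ≈ σ → G π → G σ
    has-id : G id
    ∘-closed : ∀ {π σ} → G π → G σ → G (π ∘ₚ σ)
    inv-closed : ∀ {π} → G π → G (flip π)

Refines : {n : ℕ} → LineSet n → LineSet n → Set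
Refines {n} R S = ∀ r → R r → Σ (Subset n) λ s → S s × r ⊆ s

-- R-lines inside the S-line ℓ form a linear space T on ℓ: two points of ℓ are joined by an
-- R-line, which lies in some S-line, and that S-line must be ℓ itself.  The stabiliser of ℓ
-- preserves T because G preserves R.  Every R-line r lies in an S-line s = ℓ^g, so r^{g⁻¹}
-- is an R-line inside ℓ, i.e. a T-line, and r is its image under g.
module Submission where

open import Defs
open import Data.Nat using (ℕ)
open import Data.Fin using (Fin)
open import Data.Fin.Subset using (Subset; ⊤; _∈_; _⊆_)
open import Data.Fin.Subset.Properties using (∈⊤)
open import Data.Fin.Permutation using (Permutation′; _⟨$⟩ʳ_; _⟨$⟩ˡ_; flip; inverseˡ)
open import Data.Product using (Σ; _×_; _,_; proj₁; proj₂)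
open import Data.Vec using (lookup; tabulate)
open import Data.Vec.Properties using (lookup∘tabulate; tabulate∘lookup; tabulate-cong; []=⇒lookup; lookup⇒[]=)
open import Relation.Binary.PropositionalEquality using (_≡_; _≢_; sym; trans; cong; subst; subst₂; module ≡-Reasoning)
open import Function using (_∘_)
open import Function.Bundles using (_⇔_; mk⇔)

module _ {n : ℕ} where

  lookup-^ : (l : Subset n) (π : Permutation′ n) (x : Fin n) → lookup (l ^ π) x ≡ lookup l (π ⟨$⟩ˡ x)
  lookup-^ l π = lookup∘tabulate (λ y → lookup l (π ⟨$⟩ˡ y))

  ∈-^⁻ : ∀ {l π x} → x ∈ l ^ π → π ⟨$⟩ˡ x ∈ l
  ∈-^⁻ {l} {π} {x} x∈ = lookup⇒[]= _ l (trans (sym (lookup-^ l π x)) ([]=⇒lookup x∈))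

  ∈-^⁺ : ∀ {l π x} → π ⟨$⟩ˡ x ∈ l → x ∈ l ^ π
  ∈-^⁺ {l} {π} {x} πx∈ = lookup⇒[]= x (l ^ π) (trans (lookup-^ l π x) ([]=⇒lookup πx∈))

  ^-mono : ∀ {l m} (π : Permutation′ n) → l ⊆ m → l ^ π ⊆ m ^ π
  ^-mono {l} {m} π l⊆m x∈ = ∈-^⁺ {m} {π} (l⊆m (∈-^⁻ {l} {π} x∈))

  ^-flip-^ : (l : Subset n) (π : Permutation′ n) → (l ^ π) ^ flip π ≡ l
  ^-flip-^ l π = begin
    tabulate (λ x → lookup (l ^ π) (π ⟨$⟩ʳ x))
      ≡⟨ tabulate-cong (λ x → trans (lookup-^ l π (π ⟨$⟩ʳ x)) (cong (lookup l) (inverseˡ π))) ⟩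
    tabulate (lookup l)
      ≡⟨ tabulate∘lookup l ⟩
    l ∎
    where open ≡-Reasoning

  ^-reflects-⊆ : ∀ {l m} (π : Permutation′ n) → l ^ π ⊆ m ^ π → l ⊆ m
  ^-reflects-⊆ {l} {m} π h = subst₂ (_⊆_ {n}) (^-flip-^ l π) (^-flip-^ m π) (^-mono (flip π) h)

  ⊆-^⇒^-flip-⊆ : ∀ {l m} (π : Permutation′ n) → l ⊆ m ^ π → l ^ flip π ⊆ m
  ⊆-^⇒^-flip-⊆ {l} {m} π h = subst (l ^ flip π ⊆_) (^-flip-^ m π) (^-mono (flip π) h)

  refinement-line⊆ : ∀ {pts} {S R : LineSet n} → IsLinearSpaceOn pts S → Refines R S →
    ∀ {ℓ r x y} → S ℓ → R r → x ≢ y → x ∈ r → y ∈ r → x ∈ ℓ → y ∈ ℓ → r ⊆ ℓ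
  refinement-line⊆ LS R⊑S {ℓ} {r} {x} {y} Sℓ Rr x≢y x∈r y∈r x∈ℓ y∈ℓ with R⊑S r Rr
  ... | s , Ss , r⊆s = subst (r ⊆_) s≡ℓ r⊆s
    where
    s≡ℓ : s ≡ ℓ
    s≡ℓ = IsLinearSpaceOn.join-uniq LS x y x≢y s ℓ Ss Sℓ (r⊆s x∈r) (r⊆s y∈r) x∈ℓ y∈ℓ

  restrict : LineSet n → Subset n → LineSet n
  restrict R ℓ t = R t × t ⊆ ℓ

  restrict-isLinearSpaceOn : ∀ {S R : LineSet n} {ℓ} → IsLinearSpaceOn ⊤ S → IsLinearSpaceOn ⊤ R →
    Refines R S → S ℓ → IsLinearSpaceOn ℓ (restrict R ℓ)
  restrict-isLinearSpaceOn {R = R} {ℓ} LS LR R⊑S Sℓ = record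
    { line⊆     = λ _ → proj₂
    ; line≥2    = λ l → LR.line≥2 l ∘ proj₁
    ; join      = join
    ; join-uniq = λ x y x≢y l m Tl Tm → LR.join-uniq x y x≢y l m (proj₁ Tl) (proj₁ Tm)
    }
    where
    module LR = IsLinearSpaceOn LR
    join : ∀ x y → x ∈ ℓ → y ∈ ℓ → x ≢ y → Σ (Subset n) λ t → restrict R ℓ t × x ∈ t × y ∈ t
    join x y x∈ℓ y∈ℓ x≢y with LR.join x y ∈⊤ ∈⊤ x≢y
    ... | r , Rr , x∈r , y∈r = r , (Rr , refinement-line⊆ LS R⊑S Sℓ Rr x≢y x∈r y∈r x∈ℓ y∈ℓ) , x∈r , y∈r

  restrict-isAut : ∀ {R : LineSet n} {ℓ π} → IsAut R π → ℓ ^ π ≡ ℓ → IsAut (restrict R ℓ) π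
  restrict-isAut {π = π} autR fixed l =
      (λ (Rl , l⊆ℓ) → proj₁ (autR l) Rl , subst (l ^ π ⊆_) fixed (^-mono π l⊆ℓ))
    , (λ (Rlπ , lπ⊆ℓ) → proj₂ (autR l) Rlπ , ^-reflects-⊆ π (subst (l ^ π ⊆_) (sym fixed) lπ⊆ℓ))

  refinement-line-translate : ∀ {S R : LineSet n} {G : Permutation′ n → Set} {ℓ} → IsSubgroup G → (∀ g → G g → IsAut R g) →
    Refines R S → (∀ l m → S l → S m → Σ (Permutation′ n) λ g → G g × l ^ g ≡ m) → S ℓ →
    ∀ {r} → R r → Σ (Subset n) λ t → Σ (Permutation′ n) λ g → restrict R ℓ t × G g × r ≡ t ^ g
  refinement-line-translate {ℓ = ℓ} G≤Sym autR R⊑S transitive Sℓ {r} Rr with R⊑S r Rr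
  ... | s , Ss , r⊆s with transitive ℓ s Sℓ Ss
  ... | g , Gg , ℓ^g≡s =
      r ^ flip g , g
    , (proj₁ (autR (flip g) (IsSubgroup.inv-closed G≤Sym Gg) r) Rr
      , ⊆-^⇒^-flip-⊆ g (subst (r ⊆_) (sym ℓ^g≡s) r⊆s))
    , Gg , sym (^-flip-^ r (flip g))

proposition5p3 : (n : ℕ) (S : LineSet n) (G : Permutation′ n → Set) (ℓ : Subset n) (R : LineSet n) →
    IsLinearSpaceOn ⊤ S → IsSubgroup G → (∀ g → G g → IsAut S g) →
    (∀ l m → S l → S m → Σ (Permutation′ n) λ g → G g × l ^ g ≡ m) →
    S ℓ →
    IsLinearSpaceOn ⊤ R → Refines R S → (∀ g → G g → IsAut R g) →
    Σ (LineSet n) λ T →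
      IsLinearSpaceOn ℓ T ×
      (∀ g → G g → ℓ ^ g ≡ ℓ → IsAut T g) ×
      (∀ r → R r ⇔ Σ (Subset n) λ t → Σ (Permutation′ n) λ g → T t × G g × r ≡ t ^ g)
proposition5p3 n S G ℓ R LS G≤Sym _ transitive Sℓ LR R⊑S autR =
    restrict R ℓ
  , restrict-isLinearSpaceOn LS LR R⊑S Sℓ
  , (λ g Gg → restrict-isAut {R = R} {ℓ} {g} (autR g Gg))
  , λ r → mk⇔ (refinement-line-translate G≤Sym autR R⊑S transitive Sℓ)
              (λ (t , g , (Rt , _) , Gg , r≡t^g) → subst R (sym r≡t^g) (proj₁ (autR g Gg t) Rt))
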